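{- For every integer $n\ge 3$, $\mathrm{M}(n,I_3)=\mathrm{M}(n,H_3)$ and $\mathrm{M}(n,B_3)=\mathrm{M}(n,C_3)=\mathrm{M}(n,D_3)=\mathrm{M}(n,E_3)$.
   Context: All matrices are $(0,1)$-matrices. The permutation matrix of a permutation $\sigma$ of $\{1,2,3\}$ is the $3\times 3$ matrix with $1$-entries exactly at $(i,\sigma(i))$. $I_3,H_3,B_3,C_3,D_3,E_3$ are the permutation matrices of $123,321,132,213,231,312$, respectively. An $n\times n$ matrix $A$ is strongly $Q$-forcing if for every $1$-entry $o$ of $A$ there is a $3\times 3$ submatrix of $A$ (any $3$ rows and any $3$ columns, order kept) exactly equal to $Q$ that contains $o$. $\mathrm{M}(n,Q)$ is the maximum number of $1$-entries of an $n\times n$ strongly $Q$-forcing matrix. -}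

module Defs where

open import Data.Nat using (ℕ; _≤_; _+_)
open import Data.Bool using (Bool; true; false)
open import Data.Fin using (Fin; zero; suc; _<_; _≟_)
open import Data.Product using (Σ; _×_; ∃; ∃-syntax; _,_)
open import Relation.Nullary using (does)
open import Relation.Binary.PropositionalEquality using (_≡_)

-- An m × n (0,1)-matrix: entry true = 1, false = 0.
Matrix : ℕ → ℕ → Set
Matrix m n = Fin m → Fin n → Bool

countRow : ∀ {n} → (Fin n → Bool) → ℕ
countRow {ℕ.zero} v = 0
countRow {ℕ.suc n} v with v zero
... | true  = ℕ.suc (countRow (λ j → v (suc j)))
... | false = countRow (λ j → v (suc j))

ones : ∀ {m n} → Matrix m n → ℕ
ones {ℕ.zero} A = 0
ones {ℕ.suc m} A = countRow (A zero) + ones (λ i → A (suc i))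

-- Elements of {1,2,3} as Fin 3 (0-indexed).
i1 i2 i3 : Fin 3
i1 = zero
i2 = suc zero
i3 = suc (suc zero)

permMatrix : (Fin 3 → Fin 3) → Matrix 3 3
permMatrix σ i j = does (σ i ≟ j)

oneLine : Fin 3 → Fin 3 → Fin 3 → Fin 3 → Fin 3
oneLine a b c zero = a
oneLine a b c (suc zero) = b
oneLine a b c (suc (suc zero)) = c

I₃ H₃ B₃ C₃ D₃ E₃ : Matrix 3 3
I₃ = permMatrix (oneLine i1 i2 i3)
H₃ = permMatrix (oneLine i3 i2 i1)
B₃ = permMatrix (oneLine i1 i3 i2)
C₃ = permMatrix (oneLine i2 i1 i3)
D₃ = permMatrix (oneLine i2 i3 i1)
E₃ = permMatrix (oneLine i3 i1 i2)

-- Strictly increasing map Fin 3 → Fin n (choice of 3 rows/columns, order kept).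
Increasing : ∀ {n} → (Fin 3 → Fin n) → Set
Increasing f = (f i1 < f i2) × (f i2 < f i3)

ContainsQAt : ∀ {n} → Matrix n n → Matrix 3 3 → Fin n → Fin n → Set
ContainsQAt {n} A Q x y =
  Σ (Fin 3 → Fin n) λ r → Σ (Fin 3 → Fin n) λ c →
    Increasing r × Increasing c ×
    (∀ i j → A (r i) (c j) ≡ Q i j) ×
    (∃[ k ] ∃[ l ] (r k ≡ x × c l ≡ y))

StronglyForcing : ∀ {n} → Matrix 3 3 → Matrix n n → Set
StronglyForcing {n} Q A = ∀ (x y : Fin n) → A x y ≡ true → ContainsQAt A Q x y

-- IsM n Q m  :  m = M(n,Q), i.e. m is the maximum number of 1-entries of an
-- n×n strongly Q-forcing matrix (attained, and an upper bound).
IsM : ℕ → Matrix 3 3 → ℕ → Set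
IsM n Q m =
  (Σ (Matrix n n) λ A → StronglyForcing Q A × ones A ≡ m) ×
  (∀ (A : Matrix n n) → StronglyForcing Q A → ones A ≤ m)

-- Reversing the order of the columns and transposing are bijections of the
-- n × n (0,1)-matrices that preserve the number of 1-entries and carry every
-- copy of a pattern Q onto a copy of the correspondingly transformed pattern.
-- They therefore map strongly Q-forcing matrices onto strongly Q′-forcing ones,
-- so M(n,Q) = M(n,Q′).  Column reversal exchanges I₃ with H₃ and C₃ with D₃,
-- transposition exchanges D₃ with E₃, and the half-turn (reversal of both rows
-- and columns) exchanges B₃ with C₃.
module Submission where

open import Defs
open import Data.Nat using (ℕ; _≤_)
open import Data.Product using (_×_)
open import Function.Bundles using (_⇔_)

open import Data.Nat as ℕ using (suc; s≤s)
import Data.Nat.Properties as ℕ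
open import Data.Bool using (Bool; true; false)
import Data.Bool.Properties as Bool
open import Data.Fin as Fin using (Fin; opposite; toℕ)
open import Data.Fin.Properties using (opposite-prop; opposite-involutive; toℕ<n; all?)
open import Data.Fin.Permutation using (reverse)
open import Data.Product using (_,_)
open import Function.Base using (_∘_)
open import Function.Bundles using (mk⇔)
open import Relation.Nullary.Decidable using (Dec; from-yes)
open import Relation.Binary.PropositionalEquality
open import Algebra.Properties.CommutativeMonoid.Sum ℕ.+-0-commutativeMonoid
  using (sum; sum-cong-≗; sum-permute; ∑-comm)

_≐_ : ∀ {m n} → Matrix m n → Matrix m n → Set
A ≐ B = ∀ i j → A i j ≡ B i j

_≐?_ : ∀ {m n} (A B : Matrix m n) → Dec (A ≐ B)
A ≐? B = all? λ i → all? λ j → A i j Bool.≟ B i j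

transpose : ∀ {m n} → Matrix m n → Matrix n m
transpose A i j = A j i

reverseColumns : ∀ {m n} → Matrix m n → Matrix m n
reverseColumns A i j = A i (opposite j)

rotate180 : ∀ {n} → Matrix n n → Matrix n n
rotate180 = transpose ∘ reverseColumns ∘ transpose ∘ reverseColumns

toℕ-Bool : Bool → ℕ
toℕ-Bool true  = 1
toℕ-Bool false = 0

countRow≡sum : ∀ {n} (v : Fin n → Bool) → countRow v ≡ sum (toℕ-Bool ∘ v)
countRow≡sum {ℕ.zero} v = refl
countRow≡sum {suc n} v with v Fin.zero
... | true  = cong suc (countRow≡sum (v ∘ Fin.suc))
... | false = countRow≡sum (v ∘ Fin.suc)

ones≡sum : ∀ {m n} (A : Matrix m n) → ones A ≡ sum λ i → sum λ j → toℕ-Bool (A i j)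
ones≡sum {ℕ.zero}  A = refl
ones≡sum {suc m} A = cong₂ ℕ._+_ (countRow≡sum (A Fin.zero)) (ones≡sum (A ∘ Fin.suc))

ones-transpose : ∀ {m n} (A : Matrix m n) → ones (transpose A) ≡ ones A
ones-transpose A = begin
  ones (transpose A)                         ≡⟨ ones≡sum (transpose A) ⟩
  sum (λ j → sum λ i → toℕ-Bool (A i j))     ≡⟨ ∑-comm (λ i j → toℕ-Bool (A i j)) ⟨
  sum (λ i → sum λ j → toℕ-Bool (A i j))     ≡⟨ ones≡sum A ⟨
  ones A                                     ∎
  where open ≡-Reasoning

ones-reverseColumns : ∀ {m n} (A : Matrix m n) → ones (reverseColumns A) ≡ ones A
ones-reverseColumns A = begin
  ones (reverseColumns A)                                ≡⟨ ones≡sum (reverseColumns A) ⟩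
  sum (λ i → sum λ j → toℕ-Bool (A i (opposite j)))      ≡⟨ sum-cong-≗ (λ i → sum-permute (toℕ-Bool ∘ A i) reverse) ⟨
  sum (λ i → sum λ j → toℕ-Bool (A i j))                 ≡⟨ ones≡sum A ⟨
  ones A                                                 ∎
  where open ≡-Reasoning

opposite-< : ∀ {n} {i j : Fin n} → i Fin.< j → opposite j Fin.< opposite i
opposite-< {n} {i} {j} i<j rewrite opposite-prop i | opposite-prop j =
  ℕ.∸-monoʳ-< {m = n} {n = suc (toℕ j)} {o = suc (toℕ i)} (s≤s i<j) (toℕ<n j)

Increasing-opposite : ∀ {n} {f : Fin 3 → Fin n} →
  Increasing f → Increasing (opposite ∘ f ∘ opposite)
Increasing-opposite (f₁<f₂ , f₂<f₃) = opposite-< f₂<f₃ , opposite-< f₁<f₂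

ContainsQAt-resp-≐ : ∀ {n} {A : Matrix n n} {Q Q′ : Matrix 3 3} {x y : Fin n} →
  Q ≐ Q′ → ContainsQAt A Q x y → ContainsQAt A Q′ x y
ContainsQAt-resp-≐ Q≐Q′ (r , c , ↑r , ↑c , A≐Q , at) =
  r , c , ↑r , ↑c , (λ i j → trans (A≐Q i j) (Q≐Q′ i j)) , at

ContainsQAt-transpose : ∀ {n} {A : Matrix n n} {Q : Matrix 3 3} {x y : Fin n} →
  ContainsQAt A Q x y → ContainsQAt (transpose A) (transpose Q) y x
ContainsQAt-transpose (r , c , ↑r , ↑c , A≐Q , k , l , rk≡x , cl≡y) =
  c , r , ↑c , ↑r , (λ i j → A≐Q j i) , l , k , cl≡y , rk≡x

ContainsQAt-reverseColumns : ∀ {n} {A : Matrix n n} {Q : Matrix 3 3} {x y : Fin n} →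
  ContainsQAt A Q x (opposite y) →
  ContainsQAt (reverseColumns A) (reverseColumns Q) x y
ContainsQAt-reverseColumns {A = A} {y = y} (r , c , ↑r , ↑c , A≐Q , k , l , rk≡x , cl≡y′) =
  r , opposite ∘ c ∘ opposite , ↑r , Increasing-opposite {f = c} ↑c ,
  (λ i j → trans (cong (A (r i)) (opposite-involutive _)) (A≐Q i (opposite j))) ,
  k , opposite l , rk≡x ,
  (begin
    opposite (c (opposite (opposite l)))  ≡⟨ cong (opposite ∘ c) (opposite-involutive l) ⟩
    opposite (c l)                        ≡⟨ cong opposite cl≡y′ ⟩
    opposite (opposite y)                 ≡⟨ opposite-involutive y ⟩
    y                                     ∎)
  where open ≡-Reasoning

record ForcingSymmetry (T : ∀ {n} → Matrix n n → Matrix n n) : Set where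
  field
    ones-invariant : ∀ {n} (A : Matrix n n) → ones (T A) ≡ ones A
    forcing-preserving : ∀ {n} {Q : Matrix 3 3} {A : Matrix n n} →
      StronglyForcing Q A → StronglyForcing (T Q) (T A)

open ForcingSymmetry

transpose-symmetry : ForcingSymmetry transpose
transpose-symmetry .ones-invariant = ones-transpose
transpose-symmetry .forcing-preserving {A = A} forcing x y Ayx≡1 =
  ContainsQAt-transpose {A = A} (forcing y x Ayx≡1)

reverseColumns-symmetry : ForcingSymmetry reverseColumns
reverseColumns-symmetry .ones-invariant = ones-reverseColumns
reverseColumns-symmetry .forcing-preserving {A = A} forcing x y Axy′≡1 =
  ContainsQAt-reverseColumns {A = A} (forcing x (opposite y) Axy′≡1)

∘-symmetry : ∀ {T U : ∀ {n} → Matrix n n → Matrix n n} →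
  ForcingSymmetry T → ForcingSymmetry U → ForcingSymmetry (λ A → T (U A))
∘-symmetry {U = U} S R .ones-invariant A = trans (S .ones-invariant (U A)) (R .ones-invariant A)
∘-symmetry S R .forcing-preserving = S .forcing-preserving ∘ R .forcing-preserving

rotate180-symmetry : ForcingSymmetry rotate180
rotate180-symmetry = ∘-symmetry transpose-symmetry (∘-symmetry reverseColumns-symmetry
                       (∘-symmetry transpose-symmetry reverseColumns-symmetry))

IsM-transport : ∀ {T : ∀ {n} → Matrix n n → Matrix n n} {n m} {Q Q′ : Matrix 3 3} →
  ForcingSymmetry T → T Q ≐ Q′ → T Q′ ≐ Q → IsM n Q m → IsM n Q′ m
IsM-transport {T} S TQ≐Q′ TQ′≐Q ((A , forcing , onesA≡m) , bound) =
  (T A , forcing′ TQ≐Q′ forcing , trans (S .ones-invariant A) onesA≡m) ,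
  λ A′ forcing-A′ →
    subst (_≤ _) (S .ones-invariant A′) (bound (T A′) (forcing′ TQ′≐Q forcing-A′))
  where
  forcing′ : ∀ {n} {P P′ : Matrix 3 3} {B : Matrix n n} →
    T P ≐ P′ → StronglyForcing P B → StronglyForcing P′ (T B)
  forcing′ {B = B} TP≐P′ forcing-B x y e =
    ContainsQAt-resp-≐ {A = T B} TP≐P′ (S .forcing-preserving forcing-B x y e)

IsM-⇔ : ∀ {T : ∀ {n} → Matrix n n → Matrix n n} {n m} {Q Q′ : Matrix 3 3} →
  ForcingSymmetry T → T Q ≐ Q′ → T Q′ ≐ Q → IsM n Q m ⇔ IsM n Q′ m
IsM-⇔ S TQ≐Q′ TQ′≐Q = mk⇔ (IsM-transport S TQ≐Q′ TQ′≐Q) (IsM-transport S TQ′≐Q TQ≐Q′)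

corollary4 : ∀ (n m : ℕ) → 3 ≤ n →
    (IsM n I₃ m ⇔ IsM n H₃ m) ×
    (IsM n B₃ m ⇔ IsM n C₃ m) ×
    (IsM n C₃ m ⇔ IsM n D₃ m) ×
    (IsM n D₃ m ⇔ IsM n E₃ m)
corollary4 n m _ =
  IsM-⇔ reverseColumns-symmetry (from-yes (reverseColumns I₃ ≐? H₃)) (from-yes (reverseColumns H₃ ≐? I₃)) ,
  IsM-⇔ rotate180-symmetry      (from-yes (rotate180 B₃ ≐? C₃))      (from-yes (rotate180 C₃ ≐? B₃)) ,
  IsM-⇔ reverseColumns-symmetry (from-yes (reverseColumns C₃ ≐? D₃)) (from-yes (reverseColumns D₃ ≐? C₃)) ,
  IsM-⇔ transpose-symmetry      (from-yes (transpose D₃ ≐? E₃))      (from-yes (transpose E₃ ≐? D₃))
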